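{- Let $A$ be a quantifier-free symbolic heap of full pointer arithmetic of the form $\Pi_A : t_1\mapsto t_1' * \dots * t_\ell\mapsto t_\ell'$ (each $t_i'$ a term or $\mathsf{nil}$; $\ell=0$ meaning the spatial part is $\mathsf{emp}$), and let $x_1,\dots,x_n$ be all its variables. Define the Presburger formula $$\gamma_A(x_1,\dots,x_n)\;=\;\Pi_A\wedge\bigwedge_{1\le i<j\le\ell}\big((t_i+1\le t_j)\vee(t_j+1\le t_i)\big).$$ Then for every stack $s$ assigning natural numbers to $x_1,\dots,x_n$: if $s,h\models A$ for some heap $h$ then $\gamma_A(s(x_1),\dots,s(x_n))$ is true; and conversely, if $\gamma_A(s(x_1),\dots,s(x_n))$ is true then there is a heap $h$ with $s,h\models A$.
   Context: Full pointer arithmetic: terms $t ::= x \mid t+k \mid t+t$ ($x$ a variable, $k\in\mathbb{N}$); pure formulas $\Pi ::= t=t \mid t\le t \mid t<t \mid \Pi\wedge\Pi \mid \Pi\vee\Pi \mid \neg\Pi$; spatial formulas $F ::= \mathsf{emp} \mid t\mapsto t \mid t\mapsto\mathsf{nil} \mid F*F$; a (quantifier-free) symbolic heap is $\Pi:F$. Values are natural numbers or $\mathit{nil}$. A stack $s$ maps variables to values and is extended to terms by $s(k)=k$, $s(\mathsf{nil})=\mathit{nil}$, $s(t_1+t_2)=s(t_1)+s(t_2)$. A heap is a finite partial function from $\mathbb{N}$ to values; $h_1\circ h_2$ is the union of domain-disjoint heaps. Satisfaction: $s,h\models t_1\sim t_2$ iff $s(t_1)\sim s(t_2)$; Boolean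 connectives as usual; $s,h\models\mathsf{emp}$ iff $h$ is empty; $s,h\models t_1\mapsto t_2$ iff $\mathrm{dom}(h)=\{s(t_1)\}$ and $h(s(t_1))=s(t_2)$; $s,h\models F_1*F_2$ iff $h=h_1\circ h_2$ with $s,h_1\models F_1$, $s,h_2\models F_2$; $s,h\models \Pi:F$ iff $s,h\models\Pi$ and $s,h\models F$. -}

module Defs where

open import Data.Nat using (ℕ; _+_; _≤_; _<_)
open import Data.Maybe using (Maybe; just; nothing)
open import Data.List using (List; []; _∷_)
open import Data.Product using (_×_; _,_; ∃; ∃-syntax)
open import Data.Sum using (_⊎_)
open import Relation.Nullary using (¬_)
open import Relation.Binary.PropositionalEquality using (_≡_; _≢_)

Var : Set
Var = ℕ

data Term : Set where
  var  : Var → Term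
  _+ₖ_ : Term → ℕ → Term
  _⊕_  : Term → Term → Term

data Pure : Set where
  _≐_  : Term → Term → Pure
  _≤ₚ_ : Term → Term → Pure
  _<ₚ_ : Term → Term → Pure
  _∧ₚ_ : Pure → Pure → Pure
  _∨ₚ_ : Pure → Pure → Pure
  ¬ₚ_  : Pure → Pure

data Target : Set where
  tm  : Term → Target
  nilₜ : Target

data Spatial : Set where
  emp  : Spatial
  _↦_  : Term → Target → Spatial
  _✱_  : Spatial → Spatial → Spatial

data Val : Set where
  nat : ℕ → Val
  nil : Val

-- Heaps: partial functions ℕ → Val (finiteness imposed separately)
Heap : Set
Heap = ℕ → Maybe Val

Finite : Heap → Set
Finite h = ∃[ N ] (∀ a → N ≤ a → h a ≡ nothing)

-- h = h₁ ∘ h₂ (union of domain-disjoint heaps)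
Split : Heap → Heap → Heap → Set
Split h h₁ h₂ = ∀ a → (h₁ a ≡ nothing × h a ≡ h₂ a) ⊎ (h₂ a ≡ nothing × h a ≡ h₁ a)

Stack : Set
Stack = Var → ℕ

⟦_⟧ₜ : Term → Stack → ℕ
⟦ var x ⟧ₜ s = s x
⟦ t +ₖ k ⟧ₜ s = ⟦ t ⟧ₜ s + k
⟦ t ⊕ u ⟧ₜ s = ⟦ t ⟧ₜ s + ⟦ u ⟧ₜ s

⟦_⟧ᵥ : Target → Stack → Val
⟦ tm t ⟧ᵥ s = nat (⟦ t ⟧ₜ s)
⟦ nilₜ ⟧ᵥ s = nil

_⊨ₚ_ : Stack → Pure → Set
s ⊨ₚ (t ≐ u)  = ⟦ t ⟧ₜ s ≡ ⟦ u ⟧ₜ s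
s ⊨ₚ (t ≤ₚ u) = ⟦ t ⟧ₜ s ≤ ⟦ u ⟧ₜ s
s ⊨ₚ (t <ₚ u) = ⟦ t ⟧ₜ s < ⟦ u ⟧ₜ s
s ⊨ₚ (p ∧ₚ q) = (s ⊨ₚ p) × (s ⊨ₚ q)
s ⊨ₚ (p ∨ₚ q) = (s ⊨ₚ p) ⊎ (s ⊨ₚ q)
s ⊨ₚ (¬ₚ p)   = ¬ (s ⊨ₚ p)

_,_⊨ₛ_ : Stack → Heap → Spatial → Set
s , h ⊨ₛ emp = ∀ a → h a ≡ nothing
s , h ⊨ₛ (t ↦ v) = (h (⟦ t ⟧ₜ s) ≡ just (⟦ v ⟧ᵥ s)) × (∀ a → a ≢ ⟦ t ⟧ₜ s → h a ≡ nothing)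
s , h ⊨ₛ (F ✱ G) = ∃[ h₁ ] ∃[ h₂ ] (Split h h₁ h₂ × (s , h₁ ⊨ₛ F) × (s , h₂ ⊨ₛ G))

record SymHeap : Set where
  constructor _∶_
  field
    pure  : Pure
    cells : List (Term × Target)
open SymHeap public

spatialOf : List (Term × Target) → Spatial
spatialOf [] = emp
spatialOf ((t , v) ∷ []) = t ↦ v
spatialOf ((t , v) ∷ c ∷ cs) = (t ↦ v) ✱ spatialOf (c ∷ cs)

_,_⊨_ : Stack → Heap → SymHeap → Set
s , h ⊨ A = (s ⊨ₚ pure A) × (s , h ⊨ₛ spatialOf (cells A))

sep : Term → Term → Pure
sep t u = ((t +ₖ 1) ≤ₚ u) ∨ₚ ((u +ₖ 1) ≤ₚ t)

sepAll : Pure → Term → List Term → Pure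
sepAll p t [] = p
sepAll p t (u ∷ us) = sepAll (p ∧ₚ sep t u) t us

pairwiseSep : Pure → List Term → Pure
pairwiseSep p [] = p
pairwiseSep p (t ∷ ts) = pairwiseSep (sepAll p t ts) ts

addrs : List (Term × Target) → List Term
addrs [] = []
addrs ((t , _) ∷ cs) = t ∷ addrs cs

γ : SymHeap → Pure
γ A = pairwiseSep (pure A) (addrs (cells A))

-- A model of the spatial part is a heap whose cells sit exactly at the addresses tᵢ, so these
-- addresses must be pairwise distinct; conversely, when they are distinct the heap storing tᵢ'
-- at tᵢ is a model.  Over ℕ, distinctness of tᵢ and tⱼ is exactly (tᵢ+1 ≤ tⱼ) ∨ (tⱼ+1 ≤ tᵢ).
module Submission where

open import Defs
open import Data.Product using (_×_; ∃-syntax; _,_; proj₁)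
open import Data.Nat using (ℕ; _+_; _≤_; suc; _⊔_; _≟_)
open import Data.Nat.Properties
  using (<-cmp; <⇒≢; >⇒≢; +-comm; n≮n; m⊔n≤o⇒m≤o; m⊔n≤o⇒n≤o)
open import Data.Sum using (_⊎_; inj₁; inj₂)
open import Data.List using (List; []; _∷_)
open import Data.List.Relation.Unary.All using (All; []; _∷_) renaming (map to All-map)
open import Data.List.Relation.Unary.AllPairs using (AllPairs; []; _∷_)
open import Data.Maybe using (just; nothing)
open import Data.Empty using (⊥-elim)
open import Function using (_⇔_; mk⇔; Equivalence)
open import Relation.Nullary using (yes; no)
open import Relation.Binary using (tri<; tri≈; tri>)
open import Relation.Binary.PropositionalEquality using (_≡_; _≢_; refl; sym; trans; subst)

open Equivalence using (to; from)

+1≤⊎+1≤⇔≢ : ∀ {m n} → (m + 1 ≤ n ⊎ n + 1 ≤ m) ⇔ m ≢ n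
+1≤⊎+1≤⇔≢ {m} {n} = mk⇔ separated⇒≢ ≢⇒separated
  where
    separated⇒≢ : m + 1 ≤ n ⊎ n + 1 ≤ m → m ≢ n
    separated⇒≢ (inj₁ m+1≤n) = <⇒≢ (subst (_≤ n) (+-comm m 1) m+1≤n)
    separated⇒≢ (inj₂ n+1≤m) = >⇒≢ (subst (_≤ m) (+-comm n 1) n+1≤m)

    ≢⇒separated : m ≢ n → m + 1 ≤ n ⊎ n + 1 ≤ m
    ≢⇒separated m≢n with <-cmp m n
    ... | tri< m<n _ _ = inj₁ (subst (_≤ n) (+-comm 1 m) m<n)
    ... | tri≈ _ m≡n _ = ⊥-elim (m≢n m≡n)
    ... | tri> _ _ n<m = inj₂ (subst (_≤ m) (+-comm 1 n) n<m)

Distinct : Stack → Term → Term → Set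
Distinct s t u = ⟦ t ⟧ₜ s ≢ ⟦ u ⟧ₜ s

⊨sepAll⇔ : ∀ {s} p t us → s ⊨ₚ sepAll p t us ⇔ ((s ⊨ₚ p) × All (Distinct s t) us)
⊨sepAll⇔ p t [] = mk⇔ (_, []) proj₁
⊨sepAll⇔ {s} p t (u ∷ us) = mk⇔
  (λ h → let ((hp , hu) , hus) = to (⊨sepAll⇔ (p ∧ₚ sep t u) t us) h
         in hp , to +1≤⊎+1≤⇔≢ hu ∷ hus)
  (λ { (hp , hu ∷ hus) → from (⊨sepAll⇔ (p ∧ₚ sep t u) t us) ((hp , from +1≤⊎+1≤⇔≢ hu) , hus) })

⊨pairwiseSep⇔ : ∀ {s} p ts → s ⊨ₚ pairwiseSep p ts ⇔ ((s ⊨ₚ p) × AllPairs (Distinct s) ts)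
⊨pairwiseSep⇔ p [] = mk⇔ (_, []) proj₁
⊨pairwiseSep⇔ p (t ∷ ts) = mk⇔
  (λ h → let (hsep , hts) = to (⊨pairwiseSep⇔ (sepAll p t ts) ts) h
             (hp , ht) = to (⊨sepAll⇔ p t ts) hsep
         in hp , ht ∷ hts)
  (λ { (hp , ht ∷ hts) → from (⊨pairwiseSep⇔ (sepAll p t ts) ts) (from (⊨sepAll⇔ p t ts) (hp , ht) , hts) })

Allocated : Heap → ℕ → Set
Allocated h a = h a ≢ nothing

module _ {h h₁ h₂ : Heap} (split : Split h h₁ h₂) where

  Split-allocatedˡ : ∀ {a} → Allocated h₁ a → Allocated h a
  Split-allocatedˡ {a} h₁a with split a
  ... | inj₁ (h₁a≡nothing , _) = ⊥-elim (h₁a h₁a≡nothing)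
  ... | inj₂ (_ , ha≡h₁a) = λ ha≡nothing → h₁a (trans (sym ha≡h₁a) ha≡nothing)

  Split-allocatedʳ : ∀ {a} → Allocated h₂ a → Allocated h a
  Split-allocatedʳ {a} h₂a with split a
  ... | inj₁ (_ , ha≡h₂a) = λ ha≡nothing → h₂a (trans (sym ha≡h₂a) ha≡nothing)
  ... | inj₂ (h₂a≡nothing , _) = ⊥-elim (h₂a h₂a≡nothing)

  Split-disjoint : ∀ {a b} → Allocated h₁ a → Allocated h₂ b → a ≢ b
  Split-disjoint {a} h₁a h₂a refl with split a
  ... | inj₁ (h₁a≡nothing , _) = h₁a h₁a≡nothing
  ... | inj₂ (h₂a≡nothing , _) = h₂a h₂a≡nothing

⊨↦⇒allocated : ∀ {s h} t v → s , h ⊨ₛ (t ↦ v) → Allocated h (⟦ t ⟧ₜ s)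
⊨↦⇒allocated _ _ (ht , _) ht≡nothing with trans (sym ht) ht≡nothing
... | ()

⊨cells⇒allocated : ∀ {s h} cs → s , h ⊨ₛ spatialOf cs → All (λ t → Allocated h (⟦ t ⟧ₜ s)) (addrs cs)
⊨cells⇒allocated [] _ = []
⊨cells⇒allocated ((t , v) ∷ []) ⊨t↦v = ⊨↦⇒allocated t v ⊨t↦v ∷ []
⊨cells⇒allocated ((t , v) ∷ c ∷ cs) (_ , _ , split , ⊨t↦v , ⊨rest) =
  Split-allocatedˡ split (⊨↦⇒allocated t v ⊨t↦v)
    ∷ All-map (Split-allocatedʳ split) (⊨cells⇒allocated (c ∷ cs) ⊨rest)

⊨cells⇒distinct : ∀ {s h} cs → s , h ⊨ₛ spatialOf cs → AllPairs (Distinct s) (addrs cs)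
⊨cells⇒distinct [] _ = []
⊨cells⇒distinct (_ ∷ []) _ = [] ∷ []
⊨cells⇒distinct ((t , v) ∷ c ∷ cs) (_ , _ , split , ⊨t↦v , ⊨rest) =
  All-map (Split-disjoint split (⊨↦⇒allocated t v ⊨t↦v)) (⊨cells⇒allocated (c ∷ cs) ⊨rest)
    ∷ ⊨cells⇒distinct (c ∷ cs) ⊨rest

-- An earlier cell shadows later ones at the same address; under distinctness none is shadowed.
heapOf : Stack → List (Term × Target) → Heap
heapOf s [] a = nothing
heapOf s ((t , v) ∷ cs) a with a ≟ ⟦ t ⟧ₜ s
... | yes _ = just (⟦ v ⟧ᵥ s)
... | no _ = heapOf s cs a

heapOf-finite : ∀ s cs → Finite (heapOf s cs)
heapOf-finite s [] = 0 , λ _ _ → refl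
heapOf-finite s ((t , v) ∷ cs) with heapOf-finite s cs
... | N , beyond-N = suc (⟦ t ⟧ₜ s) ⊔ N , beyond
  where
    beyond : ∀ a → suc (⟦ t ⟧ₜ s) ⊔ N ≤ a → heapOf s ((t , v) ∷ cs) a ≡ nothing
    beyond a bound with a ≟ ⟦ t ⟧ₜ s
    ... | yes refl = ⊥-elim (n≮n a (m⊔n≤o⇒m≤o (suc a) N bound))
    ... | no _ = beyond-N a (m⊔n≤o⇒n≤o (suc (⟦ t ⟧ₜ s)) N bound)

heapOf-∉ : ∀ {s a} cs → All (λ u → a ≢ ⟦ u ⟧ₜ s) (addrs cs) → heapOf s cs a ≡ nothing
heapOf-∉ [] [] = refl
heapOf-∉ {s} {a} ((t , v) ∷ cs) (a≢t ∷ a∉cs) with a ≟ ⟦ t ⟧ₜ s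
... | yes a≡t = ⊥-elim (a≢t a≡t)
... | no _ = heapOf-∉ cs a∉cs

heapOf-⊨↦ : ∀ s t v → s , heapOf s ((t , v) ∷ []) ⊨ₛ (t ↦ v)
heapOf-⊨↦ s t v = at-t , elsewhere
  where
    at-t : heapOf s ((t , v) ∷ []) (⟦ t ⟧ₜ s) ≡ just (⟦ v ⟧ᵥ s)
    at-t with ⟦ t ⟧ₜ s ≟ ⟦ t ⟧ₜ s
    ... | yes _ = refl
    ... | no t≢t = ⊥-elim (t≢t refl)

    elsewhere : ∀ a → a ≢ ⟦ t ⟧ₜ s → heapOf s ((t , v) ∷ []) a ≡ nothing
    elsewhere a a≢t with a ≟ ⟦ t ⟧ₜ s
    ... | yes a≡t = ⊥-elim (a≢t a≡t)
    ... | no _ = refl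

heapOf-split : ∀ s t v cs → All (Distinct s t) (addrs cs) →
               Split (heapOf s ((t , v) ∷ cs)) (heapOf s ((t , v) ∷ [])) (heapOf s cs)
heapOf-split s t v cs t∉cs a with a ≟ ⟦ t ⟧ₜ s
... | yes refl = inj₂ (heapOf-∉ cs t∉cs , refl)
... | no _ = inj₁ (refl , refl)

heapOf-⊨cells : ∀ s cs → AllPairs (Distinct s) (addrs cs) → s , heapOf s cs ⊨ₛ spatialOf cs
heapOf-⊨cells s [] _ _ = refl
heapOf-⊨cells s ((t , v) ∷ []) _ = heapOf-⊨↦ s t v
heapOf-⊨cells s ((t , v) ∷ c ∷ cs) (t∉cs ∷ distinct) =
  heapOf s ((t , v) ∷ []) , heapOf s (c ∷ cs) ,
  heapOf-split s t v (c ∷ cs) t∉cs , heapOf-⊨↦ s t v , heapOf-⊨cells s (c ∷ cs) distinct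

lemma1 : (A : SymHeap) (s : Stack) →
    ((∃[ h ] (Finite h × (s , h ⊨ A))) → s ⊨ₚ γ A)
    × (s ⊨ₚ γ A → ∃[ h ] (Finite h × (s , h ⊨ A)))
lemma1 (p ∶ cs) s = sound , complete
  where
    sound : ∃[ h ] (Finite h × (s , h ⊨ (p ∶ cs))) → s ⊨ₚ γ (p ∶ cs)
    sound (_ , _ , ⊨p , ⊨cells) =
      from (⊨pairwiseSep⇔ p (addrs cs)) (⊨p , ⊨cells⇒distinct cs ⊨cells)

    complete : s ⊨ₚ γ (p ∶ cs) → ∃[ h ] (Finite h × (s , h ⊨ (p ∶ cs)))
    complete ⊨γ with to (⊨pairwiseSep⇔ p (addrs cs)) ⊨γ
    ... | ⊨p , distinct = heapOf s cs , heapOf-finite s cs , ⊨p , heapOf-⊨cells s cs distinct
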